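{- Let $P\geq 3$ be an integer and let $(u_n)_{n\ge 0}$ be given by $u_0=0$, $u_1=1$, $u_n=Pu_{n-1}+u_{n-2}$ ($n\ge 2$). If $n,m$ are positive integers with $\varphi(u_n)=u_m$ and $n>1$, then $m$ is even.
   Context: $\varphi$ denotes Euler's totient function. -}

module Defs where

open import Data.Nat using (ℕ; zero; suc; _+_; _*_)
open import Data.Nat.GCD using (gcd)
open import Data.Nat.Properties using (_≟_)
open import Data.List using (List; length; filter)
open import Data.List using (upTo; map)
open import Relation.Nullary.Decidable using (Dec)

u : ℕ → ℕ → ℕ
u P zero = 0
u P (suc zero) = 1
u P (suc (suc n)) = P * u P (suc n) + u P n

φ : ℕ → ℕ
φ n = length (filter (λ k → gcd k n ≟ 1) (map suc (upTo n)))

module Submission where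

-- Suppose m = 2k + 1 is odd. The addition formula u (a + b + 1) = u (a + 1) u (b + 1) + u a u b
-- makes u m = u (k + 1)² + u k² a sum of two coprime squares, so 4 ∤ u m and every odd prime
-- factor p of u m has 4 ∣ p - 1 (a square root of -1 mod p generates a subgroup of order 4 of
-- the units mod p). Now let N = u n, so φ N = u m. If N has two coprime factors ≥ 3, or 8 ∣ N,
-- there is a square root e of 1 mod N with e ≢ ±1, and {±1, ±e} is a subgroup of order 4 of
-- the units mod N; by Lagrange 4 ∣ φ N, which is impossible. Hence N = pᵃ or N = 2pᵃ for an odd
-- prime p (N = 4 is excluded since φ 4 = 2 is not a term of the sequence), and φ N = pᵃ⁻¹ (p - 1)
-- forces a = 1. So u n = u m + 1 or u n = 2 (u m + 1); but for P ≥ 3 the sequence at least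
-- triples at every step, so no term lies strictly between u m and 3 u m.

open import Defs
open import Data.Bool using (Bool; true; false; _∧_; not; _xor_; if_then_else_)
open import Data.Bool.Properties using (xor-assoc; xor-same; ∧-identityʳ; ∧-zeroʳ; if-float)
open import Data.Empty using (⊥; ⊥-elim)
open import Data.List using (List; []; _∷_; [_]; length; filter; map; applyUpTo; _++_)
open import Data.List.Properties using (length-map; applyUpTo-∷ʳ; filter-++; length-++; map-upTo)
open import Data.List.Membership.Propositional using (_∈_; _∉_)
open import Data.List.Membership.Propositional.Properties using (∈-map⁺; ∈-map⁻)
open import Data.List.Relation.Unary.All as All using (All; []; _∷_)
import Data.List.Relation.Unary.All.Properties as All
open import Data.List.Relation.Unary.AllPairs as AllPairs using (AllPairs; []; _∷_)
import Data.List.Relation.Unary.AllPairs.Properties as AllPairs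
open import Data.List.Relation.Unary.Any using (here; there)
open import Data.List.Relation.Unary.Unique.Propositional using (Unique)
open import Data.Nat
  using (ℕ; zero; suc; _+_; _*_; _∸_; _^_; _%_; _≤_; _<_; _≟_; _≤?_; z≤n; s≤s;
         NonZero; >-nonZero; >-nonZero⁻¹; ≢-nonZero; nonTrivial⇒≢1; nonTrivial⇒n>1)
open import Data.Nat.Properties
open import Data.Nat.DivMod
open import Data.Nat.Divisibility
open import Data.Nat.Coprimality
  using (Coprime; coprime?; coprime-Bézout; coprime-divisor; coprime-+; 1-coprimeTo; prime⇒coprime)
import Data.Nat.Coprimality as Coprime
open import Data.Nat.GCD using (module Bézout; gcd)
open import Data.Nat.Induction using (<-wellFounded)
open import Data.Nat.ListAction using (product)
open import Data.Nat.Primality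
  using (Prime; prime[2]; prime⇒nonZero; prime⇒nonTrivial; prime⇒irreducible; euclidsLemma)
open import Data.Nat.Primality.Factorisation using (factorise)
open import Data.Nat.Tactic.RingSolver using (solve-∀)
open import Data.Product using (∃; ∃-syntax; _×_; _,_; proj₁; proj₂)
open import Data.Sum using (_⊎_; inj₁; inj₂)
import Data.Sum as Sum
open import Function using (_∘_; _⇔_; mk⇔; Equivalence)
open import Induction.WellFounded using (Acc; acc)
open import Relation.Binary using (IsEquivalence; Setoid)
open import Relation.Binary.PropositionalEquality hiding ([_])
import Relation.Binary.Reasoning.Setoid
open import Relation.Nullary using (¬_; Dec; does; yes; no; contradiction)
open import Relation.Nullary.Decidable using (¬?; _×-dec_; dec-true; dec-false; does-⇔)
open import Relation.Unary using (Decidable)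

module LucasSequence (P : ℕ) where

  private
    u-+-base₀ : ∀ x y → x ≡ 1 * x + 0 * y
    u-+-base₀ = solve-∀
    u-+-base₁ : ∀ p x y → p * x + y ≡ (p * 1 + 0) * x + 1 * y
    u-+-base₁ = solve-∀
    u-+-step : ∀ p a b c d →
      p * ((p * a + b) * c + a * d) + (a * c + b * d) ≡ (p * (p * a + b) + a) * c + (p * a + b) * d
    u-+-step = solve-∀

  u-+ : ∀ m n → u P (suc (m + n)) ≡ u P (suc m) * u P (suc n) + u P m * u P n
  u-+ zero n = u-+-base₀ (u P (suc n)) (u P n)
  u-+ (suc zero) n = u-+-base₁ P (u P (suc n)) (u P n)
  u-+ (suc (suc m)) n = begin
    P * u P (suc (suc m + n)) + u P (suc (m + n))
      ≡⟨ cong₂ (λ s t → P * s + t) (u-+ (suc m) n) (u-+ m n) ⟩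
    P * (u P (suc (suc m)) * u P (suc n) + u P (suc m) * u P n) + (u P (suc m) * u P (suc n) + u P m * u P n)
      ≡⟨ u-+-step P (u P (suc m)) (u P m) (u P (suc n)) (u P n) ⟩
    u P (suc (suc (suc m))) * u P (suc n) + u P (suc (suc m)) * u P n ∎
    where open ≡-Reasoning

  u-coprime-suc : ∀ n → Coprime (u P (suc n)) (u P n)
  u-coprime-suc zero (d∣1 , _) = ∣1⇒≡1 d∣1
  u-coprime-suc (suc n) (d∣u[n+2] , d∣u[n+1]) =
    u-coprime-suc n (d∣u[n+1] , ∣m+n∣m⇒∣n d∣u[n+2] (∣n⇒∣m*n P d∣u[n+1]))

  module _ (3≤P : 3 ≤ P) where

    u-triples : ∀ n → 3 * u P n ≤ u P (suc n)
    u-triples zero = z≤n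
    u-triples (suc n) = ≤-trans (*-monoˡ-≤ (u P (suc n)) 3≤P) (m≤m+n (P * u P (suc n)) (u P n))

    u-mono : ∀ {m} n → m ≤ n → u P m ≤ u P n
    u-mono zero z≤n = ≤-refl
    u-mono (suc n) m≤1+n with m≤n⇒m<n∨m≡n m≤1+n
    ... | inj₁ m<1+n = ≤-trans (u-mono n (≤-pred m<1+n)) (≤-trans (m≤n*m (u P n) 3) (u-triples n))
    ... | inj₂ refl = ≤-refl

    u-≥3 : ∀ {n} → 1 < n → 3 ≤ u P n
    u-≥3 {n} 1<n = begin
      3          ≤⟨ 3≤P ⟩
      P          ≡⟨ *-identityʳ P ⟨
      P * 1      ≡⟨ +-identityʳ (P * 1) ⟨
      u P 2      ≤⟨ u-mono n 1<n ⟩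
      u P n      ∎
      where open ≤-Reasoning

    u-gap : ∀ {m x} n → u P m < x → x < 3 * u P m → u P n ≢ x
    u-gap {m} n um<x x<3um refl with n ≤? m
    ... | yes n≤m = <⇒≱ um<x (u-mono m n≤m)
    ... | no n≰m = <⇒≱ x<3um (≤-trans (u-triples m) (u-mono n (≰⇒> n≰m)))

    u≢2 : ∀ n → u P n ≢ 2
    u≢2 n = u-gap {1} n (s≤s (s≤s z≤n)) (s≤s (s≤s (s≤s z≤n)))

    u≢u+1 : ∀ {m} n → 1 ≤ u P m → u P n ≢ u P m + 1
    u≢u+1 {m} n 1≤uₘ = u-gap {m} n (m<m+n (u P m) (s≤s z≤n)) (begin-strict
      u P m + 1          <⟨ +-monoʳ-< (u P m) (*-monoʳ-≤ 2 1≤uₘ) ⟩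
      u P m + 2 * u P m  ≡⟨ x+2x≡3x (u P m) ⟩
      3 * u P m          ∎)
      where
      open ≤-Reasoning
      x+2x≡3x : ∀ x → x + 2 * x ≡ 3 * x
      x+2x≡3x = solve-∀

    u≢2[u+1] : ∀ {m} n → 3 ≤ u P m → u P n ≢ 2 * (u P m + 1)
    u≢2[u+1] {m} n 3≤uₘ = u-gap {m} n (begin-strict
      u P m              <⟨ m<m+n (u P m) (s≤s z≤n) ⟩
      u P m + 1          ≤⟨ m≤n*m (u P m + 1) 2 ⟩
      2 * (u P m + 1)    ∎) (begin-strict
      2 * (u P m + 1)    ≡⟨ *-distribˡ-+ 2 (u P m) 1 ⟩
      2 * u P m + 2      <⟨ +-monoʳ-< (2 * u P m) 3≤uₘ ⟩
      2 * u P m + u P m  ≡⟨ 2x+x≡3x (u P m) ⟩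
      3 * u P m          ∎)
      where
      open ≤-Reasoning
      2x+x≡3x : ∀ x → 2 * x + x ≡ 3 * x
      2x+x≡3x = solve-∀


coprime-∣ʳ : ∀ {k m n} → n ∣ m → Coprime k m → Coprime k n
coprime-∣ʳ n∣m k⊥m (d∣k , d∣n) = k⊥m (d∣k , ∣-trans d∣n n∣m)

coprime-*ʳ : ∀ {k m n} → Coprime k m → Coprime k n → Coprime k (m * n)
coprime-*ʳ {k} {m} k⊥m k⊥n {d} (d∣k , d∣mn) = k⊥n (d∣k , coprime-divisor d⊥m d∣mn)
  where
  d⊥m : Coprime d m
  d⊥m (e∣d , e∣m) = k⊥m (∣-trans e∣d d∣k , e∣m)

coprime-^ʳ : ∀ {k m} → Coprime k m → ∀ n → Coprime k (m ^ n)
coprime-^ʳ {k} k⊥m zero = Coprime.sym (1-coprimeTo k)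
coprime-^ʳ k⊥m (suc n) = coprime-*ʳ k⊥m (coprime-^ʳ k⊥m n)

coprime-+⇔ : ∀ {n k} → Coprime (n + k) n ⇔ Coprime k n
coprime-+⇔ = mk⇔ (λ n+k⊥n {d} (d∣k , d∣n) → n+k⊥n (∣m∣n⇒∣m+n d∣n d∣k , d∣n)) coprime-+

coprime-2⇔odd : ∀ {k} → Coprime k 2 ⇔ (¬ 2 ∣ k)
coprime-2⇔odd = mk⇔ (λ k⊥2 2∣k → contradiction (k⊥2 (2∣k , ∣-refl)) λ ()) odd⇒coprime-2
  where
  odd⇒coprime-2 : ∀ {k} → ¬ 2 ∣ k → Coprime k 2
  odd⇒coprime-2 2∤k (d∣k , d∣2) with prime⇒irreducible prime[2] d∣2
  ... | inj₁ d≡1 = d≡1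
  ... | inj₂ refl = contradiction d∣k 2∤k

odd⇒%2≡1 : ∀ {m} → ¬ 2 ∣ m → m % 2 ≡ 1
odd⇒%2≡1 {m} 2∤m with m % 2 in m%2≡r | m%n<n m 2
... | 0 | _ = contradiction (m%n≡0⇒n∣m m 2 m%2≡r) 2∤m
... | 1 | _ = refl
... | suc (suc _) | s≤s (s≤s ())

odd+odd-even : ∀ {m n} → ¬ 2 ∣ m → ¬ 2 ∣ n → 2 ∣ m + n
odd+odd-even {m} {n} 2∤m 2∤n = m%n≡0⇒n∣m (m + n) 2
  (trans (%-distribˡ-+ m n 2) (cong₂ (λ a b → (a + b) % 2) (odd⇒%2≡1 2∤m) (odd⇒%2≡1 2∤n)))

count : (ℕ → Bool) → ℕ → ℕ
count S zero = 0
count S (suc n) = if S n then suc (count S n) else count S n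

count-cong : ∀ {S T} n → (∀ {k} → k < n → S k ≡ T k) → count S n ≡ count T n
count-cong zero _ = refl
count-cong (suc n) S≗T =
  cong₂ (λ b c → if b then suc c else c) (S≗T (n<1+n n)) (count-cong n (λ k<n → S≗T (m<n⇒m<1+n k<n)))

count-+ : ∀ (S : ℕ → Bool) m n → count S (m + n) ≡ count S m + count (λ k → S (m + k)) n
count-+ S m zero = trans (cong (count S) (+-identityʳ m)) (sym (+-identityʳ _))
count-+ S m (suc n) rewrite +-suc m n with S (m + n)
... | true = trans (cong suc (count-+ S m n)) (sym (+-suc _ _))
... | false = count-+ S m n

count-periodic : ∀ (S : ℕ → Bool) d → (∀ k → S (d + k) ≡ S k) → ∀ q → count S (q * d) ≡ q * count S d
count-periodic S d S-periodic zero = refl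
count-periodic S d S-periodic (suc q) = begin
  count S (d + q * d)                             ≡⟨ count-+ S d (q * d) ⟩
  count S d + count (λ k → S (d + k)) (q * d)     ≡⟨ cong (count S d +_) (count-cong (q * d) (λ {k} _ → S-periodic k)) ⟩
  count S d + count S (q * d)                     ≡⟨ cong (count S d +_) (count-periodic S d S-periodic q) ⟩
  count S d + q * count S d                       ∎
  where open ≡-Reasoning

count-split : ∀ (S B : ℕ → Bool) n → count (λ k → S k ∧ B k) n + count (λ k → S k ∧ not (B k)) n ≡ count S n
count-split S B zero = refl
count-split S B (suc n) with S n | B n
... | true  | true  = cong suc (count-split S B n)
... | true  | false = trans (+-suc _ _) (cong suc (count-split S B n))
... | false | _     = count-split S B n

count-rotate : ∀ (S : ℕ → Bool) n → S 0 ≡ S n → count (S ∘ suc) n ≡ count S n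
count-rotate S n S0≡Sn with S 0 | S n | S0≡Sn | count-+ S 1 n
... | true  | .true  | refl | 1+c≡1+c′ = sym (suc-injective 1+c≡1+c′)
... | false | .false | refl | c≡c′     = sym c≡c′

count-all-but-0 : ∀ (S : ℕ → Bool) n → S 0 ≡ false → (∀ {k} → 0 < k → k < n → S k ≡ true) →
                  count S n ≡ n ∸ 1
count-all-but-0 S zero S0≡false _ = refl
count-all-but-0 S (suc zero) S0≡false _ = cong (λ b → if b then 1 else 0) S0≡false
count-all-but-0 S (suc (suc n)) S0≡false S⁺ =
  cong₂ (λ b c → if b then suc c else c) (S⁺ (s≤s z≤n) (n<1+n (suc n)))
        (count-all-but-0 S (suc n) S0≡false (λ 0<k k<1+n → S⁺ 0<k (m<n⇒m<1+n k<1+n)))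

count-witness : ∀ (S : ℕ → Bool) n → count S n ≢ 0 → ∃[ x ] x < n × S x ≡ true
count-witness S zero c≢0 = contradiction refl c≢0
count-witness S (suc n) c≢0 with S n in Sn≡b
... | true  = n , n<1+n n , Sn≡b
... | false with count-witness S n c≢0
...   | x , x<n , Sx = x , m<n⇒m<1+n x<n , Sx

infixl 6 _-_ _∖_

_-_ : (ℕ → Bool) → ℕ → (ℕ → Bool)
(S - y) k = S k ∧ not (does (k ≟ y))

_∖_ : (ℕ → Bool) → List ℕ → (ℕ → Bool)
S ∖ []       = S
S ∖ (y ∷ ys) = (S ∖ ys) - y

remove-≢ : ∀ (S : ℕ → Bool) {k y} → k ≢ y → (S - y) k ≡ S k
remove-≢ S {k} {y} k≢y = trans (cong (λ b → S k ∧ not b) (dec-false (k ≟ y) k≢y)) (∧-identityʳ (S k))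

remove-self : ∀ (S : ℕ → Bool) y → (S - y) y ≡ false
remove-self S y = trans (cong (λ b → S y ∧ not b) (dec-true (y ≟ y) refl)) (∧-zeroʳ (S y))

remove⁻ : ∀ (S : ℕ → Bool) {k y} → (S - y) k ≡ true → S k ≡ true × k ≢ y
remove⁻ S {k} {y} S-y[k] with k ≟ y
... | yes refl = contradiction (trans (sym S-y[k]) (remove-self S y)) λ ()
... | no k≢y = trans (sym (remove-≢ S k≢y)) S-y[k] , k≢y

∖⁺ : ∀ (S : ℕ → Bool) {k} ys → S k ≡ true → k ∉ ys → (S ∖ ys) k ≡ true
∖⁺ S []       Sk k∉ys = Sk
∖⁺ S (y ∷ ys) Sk k∉ys = trans (remove-≢ (S ∖ ys) (k∉ys ∘ here)) (∖⁺ S ys Sk (k∉ys ∘ there))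

∖⁻ : ∀ (S : ℕ → Bool) {k} ys → (S ∖ ys) k ≡ true → S k ≡ true × k ∉ ys
∖⁻ S [] Sk = Sk , λ ()
∖⁻ S (y ∷ ys) S∖y∷ys[k] with remove⁻ (S ∖ ys) S∖y∷ys[k]
... | S∖ys[k] , k≢y with ∖⁻ S ys S∖ys[k]
...   | Sk , k∉ys = Sk , λ { (here k≡y) → k≢y k≡y ; (there k∈ys) → k∉ys k∈ys }

count-remove : ∀ {S y} n → y < n → S y ≡ true → count S n ≡ suc (count (S - y) n)
count-remove {S} {y} (suc n) y<1+n Sy with y ≟ n
... | yes refl = begin
  count S (suc y)        ≡⟨ cong (λ b → if b then suc (count S y) else count S y) Sy ⟩
  suc (count S y)        ≡⟨ cong suc (count-cong y (λ k<y → sym (remove-≢ S (<⇒≢ k<y)))) ⟩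
  suc (count (S - y) y)  ≡⟨ cong (λ b → suc (if b then suc (count (S - y) y) else count (S - y) y)) (remove-self S y) ⟨
  suc (count (S - y) (suc y)) ∎
  where open ≡-Reasoning
... | no y≢n = begin
  count S (suc n)                                 ≡⟨ cong (λ c → if S n then suc c else c) (count-remove n y<n Sy) ⟩
  (if S n then suc (suc c) else suc c)            ≡⟨ if-float suc (S n) ⟨
  suc (if S n then suc c else c)                  ≡⟨ cong (λ b → suc (if b then suc c else c)) (remove-≢ S (y≢n ∘ sym)) ⟨
  suc (count (S - y) (suc n))                     ∎
  where
  open ≡-Reasoning
  c : ℕ
  c = count (S - y) n
  y<n : y < n
  y<n = ≤∧≢⇒< (≤-pred y<1+n) y≢n

count-∖ : ∀ {S ys} n → Unique ys → All (λ y → y < n × S y ≡ true) ys →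
          count S n ≡ length ys + count (S ∖ ys) n
count-∖ n [] [] = refl
count-∖ {S} {y ∷ ys} n (y∉ys ∷ ys-unique) ((y<n , Sy) ∷ ys-in-S) = begin
  count S n                        ≡⟨ count-∖ n ys-unique ys-in-S ⟩
  length ys + count (S ∖ ys) n     ≡⟨ cong (length ys +_) (count-remove n y<n (∖⁺ S ys Sy (All.All¬⇒¬Any y∉ys))) ⟩
  length ys + suc (count (S ∖ ys - y) n) ≡⟨ +-suc (length ys) _ ⟩
  suc (length ys + count (S ∖ (y ∷ ys)) n) ∎
  where open ≡-Reasoning

length-filter-applyUpTo : ∀ {P : ℕ → Set} (P? : Decidable P) f n →
  length (filter P? (applyUpTo f n)) ≡ count (λ k → does (P? (f k))) n
length-filter-applyUpTo P? f zero = refl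
length-filter-applyUpTo P? f (suc n) = begin
  length (filter P? (applyUpTo f (suc n)))                    ≡⟨ cong (length ∘ filter P?) (applyUpTo-∷ʳ f n) ⟨
  length (filter P? (applyUpTo f n ++ [ f n ]))               ≡⟨ cong length (filter-++ P? (applyUpTo f n) [ f n ]) ⟩
  length (filter P? (applyUpTo f n) ++ filter P? [ f n ])     ≡⟨ length-++ (filter P? (applyUpTo f n)) ⟩
  length (filter P? (applyUpTo f n)) + length (filter P? [ f n ])
    ≡⟨ cong (_+ length (filter P? [ f n ])) (length-filter-applyUpTo P? f n) ⟩
  count S n + length (filter P? [ f n ])                      ≡⟨ last ⟩
  count S (suc n)                                             ∎
  where
  open ≡-Reasoning
  S : ℕ → Bool
  S k = does (P? (f k))
  last : count S n + length (filter P? [ f n ]) ≡ count S (suc n)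
  last with does (P? (f n))
  ... | true  = +-comm (count S n) 1
  ... | false = +-identityʳ (count S n)

module Modular (N : ℕ) .{{_ : NonZero N}} where

  infix 4 _≈_
  -- A record rather than a synonym for a % N ≡ b % N, so that a and b can be inferred.
  record _≈_ (a b : ℕ) : Set where
    constructor mod-≡
    field %-≡ : a % N ≡ b % N
  open _≈_ public

  ≈-isEquivalence : IsEquivalence _≈_
  ≈-isEquivalence = record
    { refl  = mod-≡ refl
    ; sym   = λ (mod-≡ p) → mod-≡ (sym p)
    ; trans = λ (mod-≡ p) (mod-≡ q) → mod-≡ (trans p q)
    }

  ≈-setoid : Setoid _ _
  ≈-setoid = record { isEquivalence = ≈-isEquivalence }

  open IsEquivalence ≈-isEquivalence public
    renaming (refl to ≈-refl; sym to ≈-sym; trans to ≈-trans; reflexive to ≈-reflexive)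

  module ≈-Reasoning = Relation.Binary.Reasoning.Setoid ≈-setoid

  %-≈ : ∀ a → a % N ≈ a
  %-≈ a = mod-≡ (m%n%n≡m%n a N)

  +-cong : ∀ {a a′ b b′} → a ≈ a′ → b ≈ b′ → a + b ≈ a′ + b′
  +-cong {a} {a′} {b} {b′} (mod-≡ p) (mod-≡ q) = mod-≡ (begin
    (a + b) % N             ≡⟨ %-distribˡ-+ a b N ⟩
    (a % N + b % N) % N     ≡⟨ cong₂ (λ x y → (x + y) % N) p q ⟩
    (a′ % N + b′ % N) % N   ≡⟨ %-distribˡ-+ a′ b′ N ⟨
    (a′ + b′) % N           ∎)
    where open ≡-Reasoning

  *-cong : ∀ {a a′ b b′} → a ≈ a′ → b ≈ b′ → a * b ≈ a′ * b′
  *-cong {a} {a′} {b} {b′} (mod-≡ p) (mod-≡ q) = mod-≡ (begin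
    (a * b) % N             ≡⟨ %-distribˡ-* a b N ⟩
    (a % N * (b % N)) % N   ≡⟨ cong₂ (λ x y → (x * y) % N) p q ⟩
    (a′ % N * (b′ % N)) % N ≡⟨ %-distribˡ-* a′ b′ N ⟨
    (a′ * b′) % N           ∎)
    where open ≡-Reasoning

  *-congˡ : ∀ a {b b′} → b ≈ b′ → a * b ≈ a * b′
  *-congˡ a = *-cong (≈-refl {a})

  *-congʳ : ∀ {a a′} b → a ≈ a′ → a * b ≈ a′ * b
  *-congʳ b a≈a′ = *-cong a≈a′ (≈-refl {b})

  +-congʳ : ∀ {a a′} b → a ≈ a′ → a + b ≈ a′ + b
  +-congʳ b a≈a′ = +-cong a≈a′ (≈-refl {b})

  +-∣ : ∀ a {k} → N ∣ k → a + k ≈ a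
  +-∣ a N∣k = mod-≡ (%-remove-+ʳ a N∣k)

  ∣⇒≈0 : ∀ {a} → N ∣ a → a ≈ 0
  ∣⇒≈0 N∣a = +-∣ 0 N∣a

  ≈0⇒∣ : ∀ {a} → a ≈ 0 → N ∣ a
  ≈0⇒∣ {a} (mod-≡ p) = m%n≡0⇒n∣m a N (trans p (m<n⇒m%n≡m (>-nonZero⁻¹ N)))

  ≈⇒≡ : ∀ {a b} → a < N → b < N → a ≈ b → a ≡ b
  ≈⇒≡ a<N b<N (mod-≡ p) = trans (sym (m<n⇒m%n≡m a<N)) (trans p (m<n⇒m%n≡m b<N))

  ∣-resp-≈ : ∀ {d a b} → d ∣ N → a ≈ b → d ∣ a → d ∣ b
  ∣-resp-≈ d∣N (mod-≡ p) d∣a = ∣n∣m%n⇒∣m d∣N (subst (_ ∣_) p (%-presˡ-∣ d∣a d∣N))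

  1+[N∸1]≡N : suc (N ∸ 1) ≡ N
  1+[N∸1]≡N = trans (+-comm 1 (N ∸ 1)) (m∸n+n≡m (>-nonZero⁻¹ N))

  +-cancelʳ : ∀ {a b} c → a + c ≈ b + c → a ≈ b
  +-cancelʳ {a} {b} c a+c≈b+c = begin
    a                         ≈⟨ +-∣ a (n∣m*n c) ⟨
    a + c * N                 ≡⟨ split a ⟩
    a + c + c * (N ∸ 1)       ≈⟨ +-congʳ (c * (N ∸ 1)) a+c≈b+c ⟩
    b + c + c * (N ∸ 1)       ≡⟨ split b ⟨
    b + c * N                 ≈⟨ +-∣ b (n∣m*n c) ⟩
    b                         ∎
    where
    open ≈-Reasoning
    split : ∀ x → x + c * N ≡ x + c + c * (N ∸ 1)
    split x = trans (cong (λ M → x + c * M) (sym 1+[N∸1]≡N))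
                (trans (cong (x +_) (*-suc c (N ∸ 1))) (sym (+-assoc x c _)))

  [N∸1]+1≈0 : N ∸ 1 + 1 ≈ 0
  [N∸1]+1≈0 = ∣⇒≈0 (subst (N ∣_) (sym (m∸n+n≡m (>-nonZero⁻¹ N))) ∣-refl)

  +1≈0⇒≈-1 : ∀ {a} → a + 1 ≈ 0 → a ≈ N ∸ 1
  +1≈0⇒≈-1 a+1≈0 = +-cancelʳ 1 (≈-trans a+1≈0 (≈-sym [N∸1]+1≈0))

  ≈-1⇒+1≈0 : ∀ {a} → a ≈ N ∸ 1 → a + 1 ≈ 0
  ≈-1⇒+1≈0 a≈-1 = ≈-trans (+-congʳ 1 a≈-1) [N∸1]+1≈0

  -1*-1≈1 : (N ∸ 1) * (N ∸ 1) ≈ 1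
  -1*-1≈1 = +-cancelʳ (N ∸ 1) (begin
    (N ∸ 1) * (N ∸ 1) + (N ∸ 1) ≡⟨ x*x+x≡x*[x+1] (N ∸ 1) ⟩
    (N ∸ 1) * (N ∸ 1 + 1)       ≈⟨ *-congˡ (N ∸ 1) [N∸1]+1≈0 ⟩
    (N ∸ 1) * 0                 ≡⟨ *-zeroʳ (N ∸ 1) ⟩
    0                           ≈⟨ [N∸1]+1≈0 ⟨
    N ∸ 1 + 1                   ≡⟨ +-comm (N ∸ 1) 1 ⟩
    1 + (N ∸ 1)                 ∎)
    where
    open ≈-Reasoning
    x*x+x≡x*[x+1] : ∀ x → x * x + x ≡ x * (x + 1)
    x*x+x≡x*[x+1] = solve-∀

  inverse⇒coprime : ∀ {a b} → a * b ≈ 1 → Coprime a N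
  inverse⇒coprime {b = b} ab≈1 (d∣a , d∣N) = ∣1⇒≡1 (∣-resp-≈ d∣N ab≈1 (∣m⇒∣m*n b d∣a))

  coprime⇒inverse : ∀ {a} → Coprime a N → ∃[ b ] a * b ≈ 1
  coprime⇒inverse {a} a⊥N with coprime-Bézout a⊥N
  ... | Bézout.+- x y 1+yN≡xa = x , (begin
    a * x     ≡⟨ *-comm a x ⟩
    x * a     ≡⟨ 1+yN≡xa ⟨
    1 + y * N ≈⟨ +-∣ 1 (n∣m*n y) ⟩
    1         ∎)
    where open ≈-Reasoning
  ... | Bézout.-+ x y 1+xa≡yN = (N ∸ 1) * x , (begin
    a * ((N ∸ 1) * x)  ≡⟨ rearrange a (N ∸ 1) x ⟩
    (N ∸ 1) * (x * a)  ≈⟨ *-congˡ (N ∸ 1) xa≈-1 ⟩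
    (N ∸ 1) * (N ∸ 1)  ≈⟨ -1*-1≈1 ⟩
    1                  ∎)
    where
    open ≈-Reasoning
    rearrange : ∀ a m x → a * (m * x) ≡ m * (x * a)
    rearrange = solve-∀
    xa≈-1 : x * a ≈ N ∸ 1
    xa≈-1 = +1≈0⇒≈-1 (∣⇒≈0 (subst (N ∣_) (trans (sym 1+xa≡yN) (+-comm 1 (x * a))) (n∣m*n y)))

  *-cancelˡ : ∀ {a x y} → Coprime a N → a * x ≈ a * y → x ≈ y
  *-cancelˡ {a} {x} {y} a⊥N ax≈ay with coprime⇒inverse a⊥N
  ... | b , ab≈1 = begin
    x             ≡⟨ *-identityˡ x ⟨
    1 * x         ≈⟨ *-congʳ x ab≈1 ⟨
    a * b * x     ≡⟨ swap b x ⟩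
    b * (a * x)   ≈⟨ *-congˡ b ax≈ay ⟩
    b * (a * y)   ≡⟨ swap b y ⟨
    a * b * y     ≈⟨ *-congʳ y ab≈1 ⟩
    1 * y         ≡⟨ *-identityˡ y ⟩
    y             ∎
    where
    open ≈-Reasoning
    swap : ∀ b z → a * b * z ≡ b * (a * z)
    swap b z = trans (*-assoc a b z) (x*[y*z]≡y*[x*z] a b z)
      where
      x*[y*z]≡y*[x*z] : ∀ x y z → x * (y * z) ≡ y * (x * z)
      x*[y*z]≡y*[x*z] = solve-∀

  coprime-resp-≈ : ∀ {a b} → a ≈ b → Coprime a N → Coprime b N
  coprime-resp-≈ a≈b a⊥N (d∣b , d∣N) = a⊥N (∣-resp-≈ d∣N (≈-sym a≈b) d∣b , d∣N)


  *-cancelʳ : ∀ {a x y} → Coprime a N → x * a ≈ y * a → x ≈ y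
  *-cancelʳ {a} {x} {y} a⊥N xa≈ya =
    *-cancelˡ a⊥N (≈-trans (≈-reflexive (*-comm a x)) (≈-trans xa≈ya (≈-reflexive (*-comm y a))))

  -1≉1 : 3 ≤ N → ¬ N ∸ 1 ≈ 1
  -1≉1 3≤N -1≈1 = <⇒≱ 3≤N (≤-reflexive (trans (sym (m∸n+n≡m 1≤N)) (cong (_+ 1) N∸1≡1)))
    where
    1≤N : 1 ≤ N
    1≤N = ≤-trans (s≤s z≤n) 3≤N
    N∸1≡1 : N ∸ 1 ≡ 1
    N∸1≡1 = ≈⇒≡ (∸-monoʳ-< (s≤s z≤n) 1≤N) (≤-trans (s≤s (s≤s z≤n)) 3≤N) -1≈1

  1+≈1⇒∣ : ∀ {a} → 1 + a ≈ 1 → N ∣ a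
  1+≈1⇒∣ {a} 1+a≈1 = ≈0⇒∣ (+-cancelʳ 1 (≈-trans (≈-reflexive (+-comm a 1)) 1+a≈1))

  ≈-1⇒∣+1 : ∀ {a} → a ≈ N ∸ 1 → N ∣ a + 1
  ≈-1⇒∣+1 a≈-1 = ≈0⇒∣ (≈-1⇒+1≈0 a≈-1)

-- Opaque so that unification treats coprimeTo N k as rigid instead of unfolding the gcd.
opaque
  coprimeTo : ℕ → ℕ → Bool
  coprimeTo N k = does (coprime? k N)

opaque
  unfolding coprimeTo

  coprimeTo⁺ : ∀ {N k} → Coprime k N → coprimeTo N k ≡ true
  coprimeTo⁺ {N} {k} = dec-true (coprime? k N)

  coprimeTo-false : ∀ {N k} → ¬ Coprime k N → coprimeTo N k ≡ false
  coprimeTo-false {N} {k} = dec-false (coprime? k N)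

  coprimeTo⁻ : ∀ {N k} → coprimeTo N k ≡ true → Coprime k N
  coprimeTo⁻ {N} {k} = does⇒ (coprime? k N)
    where
    does⇒ : ∀ {A : Set} (a? : Dec A) → does a? ≡ true → A
    does⇒ (yes a) _ = a

  coprimeTo-≡ : ∀ {M N j k} → Coprime j M ⇔ Coprime k N → coprimeTo M j ≡ coprimeTo N k
  coprimeTo-≡ {M} {N} {j} {k} j⊥M⇔k⊥N = does-⇔ j⊥M⇔k⊥N (coprime? j M) (coprime? k N)

  coprimeTo-∧ : ∀ {M N j k} {A : Set} (a? : Dec A) → Coprime j M ⇔ (Coprime k N × A) →
            coprimeTo M j ≡ coprimeTo N k ∧ does a?
  coprimeTo-∧ {M} {N} {j} {k} a? j⊥M⇔k⊥N×A = does-⇔ j⊥M⇔k⊥N×A (coprime? j M) (coprime? k N ×-dec a?)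

  -- φ counts 1, …, N and count counts 0, …, N - 1; the residues 0 and N are coprime to N together.
  φ≡count-coprimeTo : ∀ N → φ N ≡ count (coprimeTo N) N
  φ≡count-coprimeTo N = begin
    φ N                                                     ≡⟨ cong (length ∘ filter (λ k → gcd k N ≟ 1)) (map-upTo suc N) ⟩
    length (filter (λ k → gcd k N ≟ 1) (applyUpTo suc N))  ≡⟨ length-filter-applyUpTo (λ k → gcd k N ≟ 1) suc N ⟩
    count (coprimeTo N ∘ suc) N                                 ≡⟨ count-rotate (coprimeTo N) N coprimeTo[0]≡coprimeTo[N] ⟩
    count (coprimeTo N) N                                       ∎
    where
    open ≡-Reasoning
    coprimeTo[0]≡coprimeTo[N] : coprimeTo N 0 ≡ coprimeTo N N
    coprimeTo[0]≡coprimeTo[N] = coprimeTo-≡ {N} {N} {0} {N} (mk⇔ (λ 0⊥N {d} (d∣N , _) → 0⊥N (d ∣0 , d∣N))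
                                    (λ N⊥N {d} (_ , d∣N) → N⊥N (d∣N , d∣N)))

coprimeTo-periodic : ∀ N k → coprimeTo N (N + k) ≡ coprimeTo N k
coprimeTo-periodic N k = coprimeTo-≡ coprime-+⇔

φ-prime : ∀ {p} → Prime p → φ p ≡ p ∸ 1
φ-prime {p} p-prime = trans (φ≡count-coprimeTo p) (count-all-but-0 (coprimeTo p) p coprimeTo[0]≡false coprimeTo⁺-between)
  where
  coprimeTo[0]≡false : coprimeTo p 0 ≡ false
  coprimeTo[0]≡false = coprimeTo-false (λ 0⊥p → nonTrivial⇒≢1 {{prime⇒nonTrivial p-prime}} (0⊥p (p ∣0 , ∣-refl)))
  coprimeTo⁺-between : ∀ {k} → 0 < k → k < p → coprimeTo p k ≡ true
  coprimeTo⁺-between 0<k k<p = coprimeTo⁺ (Coprime.sym (prime⇒coprime p-prime {{>-nonZero 0<k}} k<p))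

φ-^ : ∀ x a → φ (x ^ suc a) ≡ x ^ a * φ x
φ-^ x a = begin
  φ (x ^ suc a)                          ≡⟨ φ≡count-coprimeTo (x ^ suc a) ⟩
  count (coprimeTo (x ^ suc a)) (x * x ^ a)  ≡⟨ count-cong (x * x ^ a) (λ {k} _ → coprimeTo-≡ (k⊥x^[1+a]⇔k⊥x k)) ⟩
  count (coprimeTo x) (x * x ^ a)            ≡⟨ cong (count (coprimeTo x)) (*-comm x (x ^ a)) ⟩
  count (coprimeTo x) (x ^ a * x)            ≡⟨ count-periodic (coprimeTo x) x (coprimeTo-periodic x) (x ^ a) ⟩
  x ^ a * count (coprimeTo x) x              ≡⟨ cong (x ^ a *_) (φ≡count-coprimeTo x) ⟨
  x ^ a * φ x                            ∎
  where
  open ≡-Reasoning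
  k⊥x^[1+a]⇔k⊥x : ∀ k → Coprime k (x ^ suc a) ⇔ Coprime k x
  k⊥x^[1+a]⇔k⊥x k = mk⇔ (coprime-∣ʳ (m∣m*n (x ^ a))) (λ k⊥x → coprime-^ʳ k⊥x (suc a))

φ-prime-^ : ∀ {p} → Prime p → ∀ a → φ (p ^ suc a) ≡ p ^ a * (p ∸ 1)
φ-prime-^ {p} p-prime a = trans (φ-^ p a) (cong (p ^ a *_) (φ-prime p-prime))

φ-2*odd : ∀ {m} → ¬ 2 ∣ m → φ (2 * m) ≡ φ m
φ-2*odd {m} 2∤m = begin
  φ (2 * m)                                                   ≡⟨ φ≡count-coprimeTo (2 * m) ⟩
  count (coprimeTo (2 * m)) (m + (m + 0))
    ≡⟨ cong (λ n → count (coprimeTo (2 * m)) (m + n)) (+-identityʳ m) ⟩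
  count (coprimeTo (2 * m)) (m + m)                               ≡⟨ count-+ (coprimeTo (2 * m)) m m ⟩
  count (coprimeTo (2 * m)) m + count (λ k → coprimeTo (2 * m) (m + k)) m
    ≡⟨ cong₂ _+_ (count-cong m (λ {k} _ → coprimeTo-∧ (¬? (2 ∣? k)) odd-part))
                 (count-cong m (λ {k} _ → coprimeTo-∧ (2 ∣? k) even-part)) ⟩
  count (λ k → coprimeTo m k ∧ not (even k)) m + count (λ k → coprimeTo m k ∧ even k) m
    ≡⟨ +-comm (count (λ k → coprimeTo m k ∧ not (even k)) m) _ ⟩
  count (λ k → coprimeTo m k ∧ even k) m + count (λ k → coprimeTo m k ∧ not (even k)) m
    ≡⟨ count-split (coprimeTo m) even m ⟩
  count (coprimeTo m) m                                           ≡⟨ φ≡count-coprimeTo m ⟨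
  φ m                                                         ∎
  where
  open ≡-Reasoning
  even : ℕ → Bool
  even k = does (2 ∣? k)
  odd-part : ∀ {j} → Coprime j (2 * m) ⇔ (Coprime j m × ¬ 2 ∣ j)
  odd-part {j} = mk⇔ to (λ (j⊥m , 2∤j) → coprime-*ʳ (Equivalence.from coprime-2⇔odd 2∤j) j⊥m)
    where
    to : Coprime j (2 * m) → Coprime j m × ¬ 2 ∣ j
    to j⊥2m = coprime-∣ʳ (n∣m*n 2) j⊥2m , Equivalence.to coprime-2⇔odd (coprime-∣ʳ (m∣m*n m) j⊥2m)
  even-part : ∀ {k} → Coprime (m + k) (2 * m) ⇔ (Coprime k m × 2 ∣ k)
  even-part {k} = mk⇔ to
    (λ (k⊥m , 2∣k) → Equivalence.from odd-part (Equivalence.from coprime-+⇔ k⊥m , 2∤m+k 2∣k))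
    where
    2∤m+k : 2 ∣ k → ¬ 2 ∣ m + k
    2∤m+k 2∣k 2∣m+k = 2∤m (∣m+n∣m⇒∣n (subst (2 ∣_) (+-comm m k) 2∣m+k) 2∣k)
    2∣k : ¬ 2 ∣ m + k → 2 ∣ k
    2∣k 2∤m+k with 2 ∣? k
    ... | yes 2∣k = 2∣k
    ... | no 2∤k = contradiction (odd+odd-even 2∤m 2∤k) 2∤m+k
    to : Coprime (m + k) (2 * m) → Coprime k m × 2 ∣ k
    to m+k⊥2m with Equivalence.to odd-part m+k⊥2m
    ... | m+k⊥m , 2∤m+k = Equivalence.to coprime-+⇔ m+k⊥m , 2∣k 2∤m+k

module Lagrange (N : ℕ) .{{_ : NonZero N}} (hs : List ℕ)
  (hs-nonempty : 0 < length hs)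
  (hs-distinct : AllPairs (λ a b → ¬ Modular._≈_ N a b) hs)
  (hs-coprime  : All (λ a → Coprime a N) hs)
  (hs-divisible : ∀ {a b} → a ∈ hs → b ∈ hs → ∃[ c ] c ∈ hs × Modular._≈_ N (a * c) b)
  where

  open Modular N

  orbit : ℕ → List ℕ
  orbit x = map (λ a → (a * x) % N) hs

  record Invariant (S : ℕ → Bool) : Set where
    field
      coprime : ∀ {y} → y < N → S y ≡ true → Coprime y N
      closed  : ∀ {a y} → a ∈ hs → y < N → S y ≡ true → S ((a * y) % N) ≡ true

  orbit-unique : ∀ {x} → Coprime x N → Unique (orbit x)
  orbit-unique x⊥N = AllPairs.map⁺ (AllPairs.map (λ a≉b ax≡bx → a≉b (*-cancelʳ x⊥N (mod-≡ ax≡bx))) hs-distinct)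

  orbit-⊆ : ∀ {S x} → Invariant S → x < N → S x ≡ true → All (λ y → y < N × S y ≡ true) (orbit x)
  orbit-⊆ {x = x} inv x<N Sx = All.map⁺ (All.tabulate (λ {a} a∈hs → m%n<n (a * x) N , Invariant.closed inv a∈hs x<N Sx))

  ∈-orbit : ∀ {x y} → y < N → Coprime x N → ∀ {a} → a ∈ hs → (a * y) % N ∈ orbit x → y ∈ orbit x
  ∈-orbit {x} {y} y<N x⊥N {a} a∈hs ay∈orbit with ∈-map⁻ (λ a → (a * x) % N) ay∈orbit
  ... | b , b∈hs , ay≡bx with hs-divisible a∈hs b∈hs
  ...   | c , c∈hs , ac≈b = subst (_∈ orbit x) (sym y≡cx) (∈-map⁺ (λ a → (a * x) % N) c∈hs)
    where
    y≈cx : y ≈ c * x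
    y≈cx = *-cancelˡ (All.lookup hs-coprime a∈hs) (begin
      a * y       ≈⟨ mod-≡ ay≡bx ⟩
      b * x       ≈⟨ *-congʳ x ac≈b ⟨
      a * c * x   ≡⟨ *-assoc a c x ⟩
      a * (c * x) ∎)
      where open ≈-Reasoning
    y≡cx : y ≡ (c * x) % N
    y≡cx = ≈⇒≡ y<N (m%n<n (c * x) N) (≈-trans y≈cx (≈-sym (%-≈ (c * x))))

  ∖-orbit : ∀ {S x} → Invariant S → x < N → S x ≡ true → Invariant (S ∖ orbit x)
  ∖-orbit {S} {x} inv x<N Sx = record
    { coprime = λ y<N S∖O[y] → Invariant.coprime inv y<N (proj₁ (∖⁻ S (orbit x) S∖O[y]))
    ; closed  = closed
    }
    where
    closed : ∀ {a y} → a ∈ hs → y < N → (S ∖ orbit x) y ≡ true → (S ∖ orbit x) ((a * y) % N) ≡ true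
    closed a∈hs y<N S∖O[y] with ∖⁻ S (orbit x) S∖O[y]
    ... | Sy , y∉O = ∖⁺ S (orbit x) (Invariant.closed inv a∈hs y<N Sy)
                        (y∉O ∘ ∈-orbit y<N (Invariant.coprime inv x<N Sx) a∈hs)

  count-∖-orbit : ∀ {S x} → Invariant S → x < N → S x ≡ true → count S N ≡ length hs + count (S ∖ orbit x) N
  count-∖-orbit {S} {x} inv x<N Sx =
    trans (count-∖ N (orbit-unique (Invariant.coprime inv x<N Sx)) (orbit-⊆ inv x<N Sx))
          (cong (_+ count (S ∖ orbit x) N) (length-map (λ a → (a * x) % N) hs))

  length-∣-count : ∀ bound S → Invariant S → count S N ≤ bound → length hs ∣ count S N
  length-∣-count bound S inv count≤bound with count S N ≟ 0
  ... | yes count≡0 = subst (length hs ∣_) (sym count≡0) (length hs ∣0)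
  ... | no count≢0 with count-witness S N count≢0 | bound
  ...   | _ | zero = contradiction (n≤0⇒n≡0 count≤bound) count≢0
  ...   | x , x<N , Sx | suc bound′ =
    subst (length hs ∣_) (sym (count-∖-orbit inv x<N Sx))
      (∣m∣n⇒∣m+n ∣-refl (length-∣-count bound′ (S ∖ orbit x) (∖-orbit inv x<N Sx) count′≤bound′))
    where
    count′≤bound′ : count (S ∖ orbit x) N ≤ bound′
    count′≤bound′ = ≤-pred (begin
      suc (count (S ∖ orbit x) N)         ≤⟨ +-monoˡ-≤ (count (S ∖ orbit x) N) hs-nonempty ⟩
      length hs + count (S ∖ orbit x) N   ≡⟨ count-∖-orbit inv x<N Sx ⟨
      count S N                           ≤⟨ count≤bound ⟩
      suc bound′                          ∎)
      where open ≤-Reasoning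

  coprimeTo-invariant : Invariant (coprimeTo N)
  coprimeTo-invariant = record
    { coprime = λ _ → coprimeTo⁻
    ; closed  = λ {a} {y} a∈hs _ y∈S → coprimeTo⁺ (coprime-resp-≈ (≈-sym (%-≈ (a * y))) (ay⊥N a∈hs (coprimeTo⁻ y∈S)))
    }
    where
    ay⊥N : ∀ {a y} → a ∈ hs → Coprime y N → Coprime (a * y) N
    ay⊥N a∈hs y⊥N = Coprime.sym (coprime-*ʳ (Coprime.sym (All.lookup hs-coprime a∈hs)) (Coprime.sym y⊥N))

  length-∣-φ : length hs ∣ φ N
  length-∣-φ = subst (length hs ∣_) (sym (φ≡count-coprimeTo N))
                 (length-∣-count (count (coprimeTo N) N) (coprimeTo N) coprimeTo-invariant ≤-refl)

xor-cancelˡ : ∀ x y → x xor (x xor y) ≡ y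
xor-cancelˡ x y = trans (sym (xor-assoc x x y)) (cong (_xor y) (xor-same x))

module SignedPowers (N : ℕ) .{{_ : NonZero N}} (3≤N : 3 ≤ N) (g : ℕ)
  (g²≈±1 : Modular._≈_ N (g * g) 1 ⊎ Modular._≈_ N (g * g) (N ∸ 1))
  (g≉1   : ¬ Modular._≈_ N g 1)
  (g≉-1  : ¬ Modular._≈_ N g (N ∸ 1))
  where

  open Modular N

  -- The index (s , b) stands for (-1)ˢ gᵇ, and σ records whether g² ≡ 1 or g² ≡ -1, so that _·_
  -- mirrors multiplication of these four residues.
  sign : Bool → ℕ
  sign false = 1
  sign true  = N ∸ 1

  power : Bool → ℕ
  power false = 1
  power true  = g

  square-sign : g * g ≈ 1 ⊎ g * g ≈ N ∸ 1 → ∃[ σ ] g * g ≈ sign σ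
  square-sign (inj₁ g²≈1)  = false , g²≈1
  square-sign (inj₂ g²≈-1) = true , g²≈-1

  σ : Bool
  σ = proj₁ (square-sign g²≈±1)

  g²≈sign : g * g ≈ sign σ
  g²≈sign = proj₂ (square-sign g²≈±1)

  Index : Set
  Index = Bool × Bool

  element : Index → ℕ
  element (s , b) = sign s * power b

  ε : Index
  ε = false , false

  _·_ : Index → Index → Index
  (s , b) · (t , c) = (b ∧ c ∧ σ) xor (s xor t) , b xor c

  _\\_ : Index → Index → Index
  (s , b) \\ (s′ , b′) = s xor ((b ∧ (b xor b′) ∧ σ) xor s′) , b xor b′

  ·-\\ : ∀ i j → i · (i \\ j) ≡ j
  ·-\\ (s , b) (s′ , b′) = cong₂ _,_
    (trans (cong (b∧c∧σ xor_) (xor-cancelˡ s (b∧c∧σ xor s′))) (xor-cancelˡ b∧c∧σ s′))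
    (xor-cancelˡ b b′)
    where
    b∧c∧σ : Bool
    b∧c∧σ = b ∧ (b xor b′) ∧ σ

  ·-identityʳ : ∀ i → i · ε ≡ i
  ·-identityʳ (false , false) = refl
  ·-identityʳ (false , true)  = refl
  ·-identityʳ (true  , false) = refl
  ·-identityʳ (true  , true)  = refl

  sign-* : ∀ s t → sign s * sign t ≈ sign (s xor t)
  sign-* false t     = ≈-reflexive (*-identityˡ (sign t))
  sign-* true  false = ≈-reflexive (*-identityʳ (N ∸ 1))
  sign-* true  true  = -1*-1≈1

  power-* : ∀ b c → power b * power c ≈ sign (b ∧ c ∧ σ) * power (b xor c)
  power-* false c     = ≈-refl
  power-* true  false = ≈-reflexive (*-comm g 1)
  power-* true  true  = ≈-trans g²≈sign (≈-reflexive (sym (*-identityʳ (sign σ))))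

  element-· : ∀ i j → element i * element j ≈ element (i · j)
  element-· (s , b) (t , c) = begin
    sign s * power b * (sign t * power c)                 ≡⟨ interchange (sign s) (power b) (sign t) (power c) ⟩
    sign s * sign t * (power b * power c)                 ≈⟨ *-cong (sign-* s t) (power-* b c) ⟩
    sign (s xor t) * (sign (b ∧ c ∧ σ) * power (b xor c)) ≡⟨ rotate (sign (s xor t)) (sign (b ∧ c ∧ σ)) (power (b xor c)) ⟩
    sign (b ∧ c ∧ σ) * sign (s xor t) * power (b xor c)   ≈⟨ *-congʳ (power (b xor c)) (sign-* (b ∧ c ∧ σ) (s xor t)) ⟩
    element ((s , b) · (t , c))                           ∎
    where
    open ≈-Reasoning
    interchange : ∀ a b c d → a * b * (c * d) ≡ a * c * (b * d)
    interchange = solve-∀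
    rotate : ∀ a b c → a * (b * c) ≡ b * a * c
    rotate = solve-∀

  element-coprime : ∀ i → Coprime (element i) N
  element-coprime i = inverse⇒coprime (≈-trans (element-· i (i \\ ε)) (≈-reflexive (cong element (·-\\ i ε))))

  element≈1 : ∀ i → element i ≈ 1 → i ≡ ε
  element≈1 (false , false) _ = refl
  element≈1 (true , false) -1*1≈1 = contradiction (≈-trans (≈-reflexive (sym (*-identityʳ (N ∸ 1)))) -1*1≈1) (-1≉1 3≤N)
  element≈1 (false , true) 1*g≈1 = contradiction (≈-trans (≈-reflexive (sym (*-identityˡ g))) 1*g≈1) g≉1
  element≈1 (true , true) -g≈1 = contradiction (begin
    g                          ≡⟨ *-identityˡ g ⟨
    1 * g                      ≈⟨ *-congʳ g -1*-1≈1 ⟨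
    (N ∸ 1) * (N ∸ 1) * g      ≡⟨ *-assoc (N ∸ 1) (N ∸ 1) g ⟩
    (N ∸ 1) * ((N ∸ 1) * g)    ≈⟨ *-congˡ (N ∸ 1) -g≈1 ⟩
    (N ∸ 1) * 1                ≡⟨ *-identityʳ (N ∸ 1) ⟩
    N ∸ 1                      ∎) g≉-1
    where open ≈-Reasoning

  element-injective : ∀ {i j} → element i ≈ element j → i ≡ j
  element-injective {i} {j} eᵢ≈eⱼ = begin
    i                ≡⟨ ·-\\ j i ⟨
    j · (j \\ i)     ≡⟨ cong (j ·_) (element≈1 (j \\ i) eⱼ\\ᵢ≈1) ⟩
    j · ε            ≡⟨ ·-identityʳ j ⟩
    j                ∎
    where
    open ≡-Reasoning
    eⱼ\\ᵢ≈1 : element (j \\ i) ≈ 1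
    eⱼ\\ᵢ≈1 = *-cancelˡ (element-coprime j) (≈-trans (element-· j (j \\ i)) (≈-trans
               (≈-reflexive (cong element (·-\\ j i))) (≈-trans eᵢ≈eⱼ (≈-reflexive (sym (*-identityʳ (element j)))))))

  indices : List Index
  indices = (false , false) ∷ (true , false) ∷ (false , true) ∷ (true , true) ∷ []

  indices-unique : Unique indices
  indices-unique = ((λ ()) ∷ (λ ()) ∷ (λ ()) ∷ []) ∷ ((λ ()) ∷ (λ ()) ∷ []) ∷ ((λ ()) ∷ []) ∷ [] ∷ []

  ∈-indices : ∀ i → i ∈ indices
  ∈-indices (false , false) = here refl
  ∈-indices (true  , false) = there (here refl)
  ∈-indices (false , true)  = there (there (here refl))
  ∈-indices (true  , true)  = there (there (there (here refl)))

  elements-divisible : ∀ {a b} → a ∈ map element indices → b ∈ map element indices →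
                       ∃[ c ] c ∈ map element indices × a * c ≈ b
  elements-divisible a∈ b∈ with ∈-map⁻ element {xs = indices} a∈ | ∈-map⁻ element {xs = indices} b∈
  ... | i , _ , refl | j , _ , refl =
    element (i \\ j) , ∈-map⁺ element (∈-indices (i \\ j)) ,
    ≈-trans (element-· i (i \\ j)) (≈-reflexive (cong element (·-\\ i j)))

  4∣φ : 4 ∣ φ N
  4∣φ = Lagrange.length-∣-φ N (map element indices) (s≤s z≤n)
    (AllPairs.map⁺ {f = element}
      (AllPairs.map (λ {i} {j} i≢j eᵢ≈eⱼ → i≢j (element-injective {i} {j} eᵢ≈eⱼ)) indices-unique))
    (All.map⁺ {f = element} (All.universal element-coprime indices))
    elements-divisible

≥3⇒∤2 : ∀ {d} → 3 ≤ d → ¬ d ∣ 2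
≥3⇒∤2 3≤d d∣2 = <⇒≱ 3≤d (∣⇒≤ d∣2)

-- e = 2t + 1 is ≡ 1 mod C and ≡ -1 mod D, hence a square root of 1 mod C D other than ±1.
4∣φ-split : ∀ {C D t} → 3 ≤ C → 3 ≤ D → C ∣ t → D ∣ t + 1 → 4 ∣ φ (C * D)
4∣φ-split {C} {D} {t} 3≤C 3≤D C∣t@(divides a t≡aC) D∣t+1@(divides b t+1≡bD) =
  SignedPowers.4∣φ (C * D) 3≤CD e (inj₁ e²≈1) e≉1 e≉-1
  where
  3≤CD : 3 ≤ C * D
  3≤CD = ≤-trans 3≤C (m≤m*n C D {{>-nonZero (≤-trans (s≤s z≤n) 3≤D)}})
  instance
    CD≢0 : NonZero (C * D)
    CD≢0 = >-nonZero (≤-trans (s≤s z≤n) 3≤CD)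
  open Modular (C * D)
  e : ℕ
  e = 1 + 2 * t
  e²≈1 : e * e ≈ 1
  e²≈1 = begin
    e * e                         ≡⟨ square t ⟩
    1 + 4 * t * (t + 1)           ≡⟨ cong₂ (λ x y → 1 + 4 * x * y) t≡aC t+1≡bD ⟩
    1 + 4 * (a * C) * (b * D)     ≡⟨ regroup a b C D ⟩
    1 + 4 * a * b * (C * D)       ≈⟨ +-∣ 1 (n∣m*n (4 * a * b)) ⟩
    1                             ∎
    where
    open ≈-Reasoning
    square : ∀ t → (1 + 2 * t) * (1 + 2 * t) ≡ 1 + 4 * t * (t + 1)
    square = solve-∀
    regroup : ∀ a b c d → 1 + 4 * (a * c) * (b * d) ≡ 1 + 4 * a * b * (c * d)
    regroup = solve-∀
  2t+2≡2[t+1] : 2 * t + 2 ≡ 2 * (t + 1)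
  2t+2≡2[t+1] = sym (*-distribˡ-+ 2 t 1)
  e≉1 : ¬ e ≈ 1
  e≉1 e≈1 = ≥3⇒∤2 3≤D (∣m+n∣m⇒∣n (subst (D ∣_) (sym 2t+2≡2[t+1]) (∣n⇒∣m*n 2 D∣t+1))
                                (∣-trans (n∣m*n C) (1+≈1⇒∣ e≈1)))
  e≉-1 : ¬ e ≈ C * D ∸ 1
  e≉-1 e≈-1 = ≥3⇒∤2 3≤C (∣m+n∣m⇒∣n (∣-trans (m∣m*n D) (subst (C * D ∣_) e+1≡2t+2 (≈-1⇒∣+1 e≈-1)))
                                  (∣n⇒∣m*n 2 C∣t))
    where
    e+1≡2t+2 : e + 1 ≡ 2 * t + 2
    e+1≡2t+2 = trans (+-comm 1 (2 * t + 1)) (+-assoc (2 * t) 1 1)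

4∣φ-coprime-* : ∀ {A B} → 3 ≤ A → 3 ≤ B → Coprime A B → 4 ∣ φ (A * B)
4∣φ-coprime-* {A} {B} 3≤A 3≤B A⊥B with coprime-Bézout A⊥B
... | Bézout.+- x y 1+yB≡xA = subst (λ n → 4 ∣ φ n) (*-comm B A)
        (4∣φ-split 3≤B 3≤A (n∣m*n y) (divides x (trans (+-comm (y * B) 1) 1+yB≡xA)))
... | Bézout.-+ x y 1+xA≡yB = 4∣φ-split 3≤A 3≤B (n∣m*n x) (divides y (trans (+-comm (x * A) 1) 1+xA≡yB))

4∣φ-8* : ∀ k .{{_ : NonZero k}} → 4 ∣ φ (8 * k)
4∣φ-8* k = SignedPowers.4∣φ (8 * k) 3≤8k e (inj₁ e²≈1) e≉1 e≉-1
  where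
  3≤8k : 3 ≤ 8 * k
  3≤8k = ≤-trans (s≤s (s≤s (s≤s z≤n))) (m≤m*n 8 k)
  instance
    8k≢0 : NonZero (8 * k)
    8k≢0 = >-nonZero (≤-trans (s≤s z≤n) 3≤8k)
  open Modular (8 * k)
  e : ℕ
  e = 1 + 4 * k
  e²≈1 : e * e ≈ 1
  e²≈1 = begin
    e * e                     ≡⟨ square k ⟩
    1 + (2 * k + 1) * (8 * k) ≈⟨ +-∣ 1 (n∣m*n (2 * k + 1)) ⟩
    1                         ∎
    where
    open ≈-Reasoning
    square : ∀ k → (1 + 4 * k) * (1 + 4 * k) ≡ 1 + (2 * k + 1) * (8 * k)
    square = solve-∀
  8k∤4k+ : ∀ {r} → r ≤ 2 → ¬ 8 * k ∣ 4 * k + r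
  8k∤4k+ {r} r≤2 8k∣4k+r = <⇒≱ 4k+r<8k (∣⇒≤ {{>-nonZero 0<4k+r}} 8k∣4k+r)
    where
    0<4k+r : 0 < 4 * k + r
    0<4k+r = ≤-trans (s≤s z≤n) (≤-trans (m≤m*n 4 k) (m≤m+n (4 * k) r))
    4k+r<8k : 4 * k + r < 8 * k
    4k+r<8k = begin-strict
      4 * k + r      ≤⟨ +-monoʳ-≤ (4 * k) r≤2 ⟩
      4 * k + 2      <⟨ +-monoʳ-< (4 * k) (s≤s (s≤s (s≤s z≤n))) ⟩
      4 * k + 4      ≤⟨ +-monoʳ-≤ (4 * k) (m≤m*n 4 k) ⟩
      4 * k + 4 * k  ≡⟨ double k ⟩
      8 * k          ∎
      where
      open ≤-Reasoning
      double : ∀ k → 4 * k + 4 * k ≡ 8 * k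
      double = solve-∀
  e≉1 : ¬ e ≈ 1
  e≉1 e≈1 = 8k∤4k+ z≤n (subst (8 * k ∣_) (sym (+-identityʳ (4 * k))) (1+≈1⇒∣ e≈1))
  e≉-1 : ¬ e ≈ 8 * k ∸ 1
  e≉-1 e≈-1 = 8k∤4k+ ≤-refl (subst (8 * k ∣_) e+1≡4k+2 (≈-1⇒∣+1 e≈-1))
    where
    e+1≡4k+2 : e + 1 ≡ 4 * k + 2
    e+1≡4k+2 = trans (+-comm 1 (4 * k + 1)) (+-assoc (4 * k) 1 1)

prime∤⇒coprime : ∀ {p n} → Prime p → ¬ p ∣ n → Coprime p n
prime∤⇒coprime p-prime p∤n (d∣p , d∣n) with prime⇒irreducible p-prime d∣p
... | inj₁ d≡1 = d≡1
... | inj₂ refl = contradiction d∣n p∤n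

sum-of-squares-mod-4 : ∀ r s → r < 4 → s < 4 → (r * r + s * s) % 4 ≡ 0 → 2 ∣ r × 2 ∣ s
sum-of-squares-mod-4 0 0 _ _ _ = 2 ∣0 , 2 ∣0
sum-of-squares-mod-4 0 2 _ _ _ = 2 ∣0 , ∣-refl
sum-of-squares-mod-4 2 0 _ _ _ = ∣-refl , 2 ∣0
sum-of-squares-mod-4 2 2 _ _ _ = ∣-refl , ∣-refl
sum-of-squares-mod-4 0 1 _ _ ()
sum-of-squares-mod-4 0 3 _ _ ()
sum-of-squares-mod-4 1 0 _ _ ()
sum-of-squares-mod-4 1 1 _ _ ()
sum-of-squares-mod-4 1 2 _ _ ()
sum-of-squares-mod-4 1 3 _ _ ()
sum-of-squares-mod-4 2 1 _ _ ()
sum-of-squares-mod-4 2 3 _ _ ()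
sum-of-squares-mod-4 3 0 _ _ ()
sum-of-squares-mod-4 3 1 _ _ ()
sum-of-squares-mod-4 3 2 _ _ ()
sum-of-squares-mod-4 3 3 _ _ ()
sum-of-squares-mod-4 (suc (suc (suc (suc _)))) _ (s≤s (s≤s (s≤s (s≤s ())))) _ _
sum-of-squares-mod-4 _ (suc (suc (suc (suc _)))) _ (s≤s (s≤s (s≤s (s≤s ())))) _

4∤sum-of-coprime-squares : ∀ {x y} → Coprime x y → ¬ 4 ∣ x * x + y * y
4∤sum-of-coprime-squares {x} {y} x⊥y 4∣x²+y²
  with sum-of-squares-mod-4 (x % 4) (y % 4) (m%n<n x 4) (m%n<n y 4) residues²≡0
  where
  open Modular 4
  residues²≡0 : (x % 4 * (x % 4) + y % 4 * (y % 4)) % 4 ≡ 0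
  residues²≡0 = %-≡ (≈-trans (+-cong (*-cong (%-≈ x) (%-≈ x)) (*-cong (%-≈ y) (%-≈ y))) (∣⇒≈0 4∣x²+y²))
... | 2∣x%4 , 2∣y%4 = contradiction (x⊥y (∣n∣m%n⇒∣m 2∣4 2∣x%4 , ∣n∣m%n⇒∣m 2∣4 2∣y%4)) λ ()
  where
  2∣4 : 2 ∣ 4
  2∣4 = divides 2 refl

prime∣sum-of-coprime-squares : ∀ {p x y} → Prime p → 3 ≤ p → Coprime x y → p ∣ x * x + y * y → 4 ∣ p ∸ 1
prime∣sum-of-coprime-squares {p} {x} {y} p-prime 3≤p x⊥y p∣x²+y² =
  subst (4 ∣_) (φ-prime p-prime) (SignedPowers.4∣φ p 3≤p c (inj₂ c²≈-1) c≉1 c≉-1)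
  where
  instance
    p≢0 : NonZero p
    p≢0 = prime⇒nonZero p-prime
  open Modular p
  p∤x : ¬ p ∣ x
  p∤x p∣x with euclidsLemma y y p-prime (∣m+n∣m⇒∣n p∣x²+y² (∣m⇒∣m*n x p∣x))
  ... | inj₁ p∣y = nonTrivial⇒≢1 {{prime⇒nonTrivial p-prime}} (x⊥y (p∣x , p∣y))
  ... | inj₂ p∣y = nonTrivial⇒≢1 {{prime⇒nonTrivial p-prime}} (x⊥y (p∣x , p∣y))
  inverse : ∃[ x′ ] x * x′ ≈ 1
  inverse = coprime⇒inverse (Coprime.sym (prime∤⇒coprime p-prime p∤x))
  x′ : ℕ
  x′ = proj₁ inverse
  c : ℕ
  c = y * x′
  c²≈-1 : c * c ≈ p ∸ 1
  c²≈-1 = +1≈0⇒≈-1 (begin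
    c * c + 1                          ≈⟨ +-cong (≈-refl {c * c}) (*-cong (proj₂ inverse) (proj₂ inverse)) ⟨
    c * c + x * x′ * (x * x′)          ≡⟨ factor x y x′ ⟩
    x′ * x′ * (x * x + y * y)          ≈⟨ *-congˡ (x′ * x′) (∣⇒≈0 p∣x²+y²) ⟩
    x′ * x′ * 0                        ≡⟨ *-zeroʳ (x′ * x′) ⟩
    0                                  ∎)
    where
    open ≈-Reasoning
    factor : ∀ x y x′ → y * x′ * (y * x′) + x * x′ * (x * x′) ≡ x′ * x′ * (x * x + y * y)
    factor = solve-∀
  c²≉1 : ¬ c * c ≈ 1
  c²≉1 c²≈1 = -1≉1 3≤p (≈-trans (≈-sym c²≈-1) c²≈1)
  c≉1 : ¬ c ≈ 1
  c≉1 c≈1 = c²≉1 (*-cong c≈1 c≈1)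
  c≉-1 : ¬ c ≈ p ∸ 1
  c≉-1 c≈-1 = c²≉1 (≈-trans (*-cong c≈-1 c≈-1) -1*-1≈1)

factor-out : ∀ {p} → 1 < p → ∀ n → n ≢ 0 → ∃[ a ] ∃[ r ] n ≡ p ^ a * r × ¬ p ∣ r
factor-out {p} 1<p n = go n (<-wellFounded n)
  where
  go : ∀ n → Acc _<_ n → n ≢ 0 → ∃[ a ] ∃[ r ] n ≡ p ^ a * r × ¬ p ∣ r
  go n (acc smaller) n≢0 with p ∣? n
  ... | no p∤n = 0 , n , sym (+-identityʳ n) , p∤n
  ... | yes (divides q n≡qp) with go q (smaller q<n) q≢0
    where
    q≢0 : q ≢ 0
    q≢0 refl = n≢0 n≡qp
    q<n : q < n
    q<n = subst (q <_) (sym n≡qp) (m<m*n q p {{≢-nonZero q≢0}} 1<p)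
  ...   | a , r , q≡pᵃr , p∤r = suc a , r , trans n≡qp (trans (cong (_* p) q≡pᵃr) (rotate (p ^ a) r p)) , p∤r
    where
    rotate : ∀ x r p → x * r * p ≡ p * x * r
    rotate = solve-∀

prime-factor : ∀ {n} → 1 < n → ∃[ p ] Prime p × p ∣ n
prime-factor {n} 1<n with factorise n {{>-nonZero (<-trans (s≤s z≤n) 1<n)}}
... | record { factors = [] ; isFactorisation = n≡1 } = contradiction n≡1 (>⇒≢ 1<n)
... | record { factors = p ∷ ps ; isFactorisation = n≡p*Πps ; factorsPrime = p-prime ∷ _ } =
  p , p-prime , divides (product ps) (trans n≡p*Πps (*-comm p (product ps)))

odd-prime⇒odd : ∀ {p} → Prime p → 3 ≤ p → ¬ 2 ∣ p
odd-prime⇒odd p-prime 3≤p 2∣p with prime⇒irreducible p-prime 2∣p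
... | inj₁ ()
... | inj₂ refl = contradiction 3≤p λ { (s≤s (s≤s ())) }

odd-prime⇒odd-power : ∀ {p} → Prime p → 3 ≤ p → ∀ n → ¬ 2 ∣ p ^ n
odd-prime⇒odd-power p-prime 3≤p n = Equivalence.to coprime-2⇔odd
  (Coprime.sym (coprime-^ʳ (Coprime.sym (Equivalence.from coprime-2⇔odd (odd-prime⇒odd p-prime 3≤p))) n))

module Classification {N : ℕ} (3≤N : 3 ≤ N) (4∤φN : ¬ 4 ∣ φ N) (φN≢2 : φ N ≢ 2)
  (prime-factors≡1[4] : ∀ {q} → Prime q → 3 ≤ q → q ∣ φ N → 4 ∣ q ∸ 1)
  where

  N≢0 : N ≢ 0
  N≢0 refl = contradiction 3≤N λ ()

  not-power-of-2 : ∀ j → N ≢ 2 ^ j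
  not-power-of-2 0 refl = contradiction 3≤N λ { (s≤s ()) }
  not-power-of-2 1 refl = contradiction 3≤N λ { (s≤s (s≤s ())) }
  not-power-of-2 2 refl = φN≢2 refl
  not-power-of-2 (suc (suc (suc i))) refl =
    4∤φN (subst (λ n → 4 ∣ φ n) (eight (2 ^ i)) (4∣φ-8* (2 ^ i) {{m^n≢0 2 i}}))
    where
    eight : ∀ x → 8 * x ≡ 2 * (2 * (2 * x))
    eight = solve-∀

  exponent≡0 : ∀ {p a} → Prime p → 3 ≤ p → φ N ≡ p ^ a * (p ∸ 1) → a ≡ 0
  exponent≡0 {a = zero} _ _ _ = refl
  exponent≡0 {p} {suc a} p-prime 3≤p φN≡pᵃ⁺¹[p-1] = contradiction (∣-trans 4∣p-1 p-1∣φN) 4∤φN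
    where
    p-1∣φN : p ∸ 1 ∣ φ N
    p-1∣φN = subst (p ∸ 1 ∣_) (sym φN≡pᵃ⁺¹[p-1]) (n∣m*n (p ^ suc a))
    4∣p-1 : 4 ∣ p ∸ 1
    4∣p-1 = prime-factors≡1[4] p-prime 3≤p
              (subst (p ∣_) (sym φN≡pᵃ⁺¹[p-1]) (∣m⇒∣m*n (p ∸ 1) (m∣m*n (p ^ a))))

  prime-power-case : ∀ {p a} → Prime p → 3 ≤ p → φ N ≡ p ^ a * (p ∸ 1) →
                     N ≡ p ^ suc a ⊎ N ≡ 2 * p ^ suc a → 3 ≤ φ N × (N ≡ φ N + 1 ⊎ N ≡ 2 * (φ N + 1))
  prime-power-case {p} {a} p-prime 3≤p φN≡pᵃ[p-1] N≡pᵃ⁺¹⊎2pᵃ⁺¹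
    with refl ← exponent≡0 {p} {a} p-prime 3≤p φN≡pᵃ[p-1] =
    ≤∧≢⇒< 2≤φN (φN≢2 ∘ sym) ,
    Sum.map (λ N≡p*1 → trans N≡p*1 p*1≡φN+1) (λ N≡2p*1 → trans N≡2p*1 (cong (2 *_) p*1≡φN+1)) N≡pᵃ⁺¹⊎2pᵃ⁺¹
    where
    φN≡p-1 : φ N ≡ p ∸ 1
    φN≡p-1 = trans φN≡pᵃ[p-1] (*-identityˡ (p ∸ 1))
    p*1≡φN+1 : p * 1 ≡ φ N + 1
    p*1≡φN+1 = trans (*-identityʳ p) (trans (sym (m∸n+n≡m (≤-trans (s≤s z≤n) 3≤p))) (cong (_+ 1) (sym φN≡p-1)))
    2≤φN : 2 ≤ φ N
    2≤φN = subst (2 ≤_) (sym φN≡p-1) (∸-monoˡ-≤ 1 3≤p)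

  odd-prime-divisor : ∀ {p} → Prime p → 3 ≤ p → p ∣ N → 3 ≤ φ N × (N ≡ φ N + 1 ⊎ N ≡ 2 * (φ N + 1))
  odd-prime-divisor {p} p-prime 3≤p p∣N with factor-out (nonTrivial⇒n>1 p {{prime⇒nonTrivial p-prime}}) N N≢0
  ... | zero , r , N≡r , p∤r = contradiction (subst (p ∣_) (trans N≡r (+-identityʳ r)) p∣N) p∤r
  ... | suc a , 0 , _ , p∤0 = contradiction (p ∣0) p∤0
  ... | suc a , 1 , N≡pᵃ⁺¹*1 , _ =
    prime-power-case {a = a} p-prime 3≤p (trans (cong φ N≡pᵃ⁺¹) (φ-prime-^ p-prime a)) (inj₁ N≡pᵃ⁺¹)
    where
    N≡pᵃ⁺¹ : N ≡ p ^ suc a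
    N≡pᵃ⁺¹ = trans N≡pᵃ⁺¹*1 (*-identityʳ (p ^ suc a))
  ... | suc a , 2 , N≡pᵃ⁺¹*2 , _ =
    prime-power-case {a = a} p-prime 3≤p φN≡pᵃ[p-1] (inj₂ N≡2pᵃ⁺¹)
    where
    N≡2pᵃ⁺¹ : N ≡ 2 * p ^ suc a
    N≡2pᵃ⁺¹ = trans N≡pᵃ⁺¹*2 (*-comm (p ^ suc a) 2)
    φN≡pᵃ[p-1] : φ N ≡ p ^ a * (p ∸ 1)
    φN≡pᵃ[p-1] = begin
      φ N               ≡⟨ cong φ N≡2pᵃ⁺¹ ⟩
      φ (2 * p ^ suc a) ≡⟨ φ-2*odd (odd-prime⇒odd-power p-prime 3≤p (suc a)) ⟩
      φ (p ^ suc a)     ≡⟨ φ-prime-^ p-prime a ⟩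
      p ^ a * (p ∸ 1)   ∎
      where open ≡-Reasoning
  ... | suc a , r@(suc (suc (suc _))) , N≡pᵃ⁺¹r , p∤r =
    contradiction (subst (λ n → 4 ∣ φ n) (sym N≡pᵃ⁺¹r) (4∣φ-coprime-* 3≤pᵃ⁺¹ (s≤s (s≤s (s≤s z≤n))) pᵃ⁺¹⊥r))
                  4∤φN
    where
    instance
      p≢0 : NonZero p
      p≢0 = prime⇒nonZero p-prime
    3≤pᵃ⁺¹ : 3 ≤ p ^ suc a
    3≤pᵃ⁺¹ = ≤-trans 3≤p (m≤m*n p (p ^ a) {{m^n≢0 p a}})
    pᵃ⁺¹⊥r : Coprime (p ^ suc a) r
    pᵃ⁺¹⊥r = Coprime.sym (coprime-^ʳ (Coprime.sym (prime∤⇒coprime p-prime p∤r)) (suc a))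

  classify : 3 ≤ φ N × (N ≡ φ N + 1 ⊎ N ≡ 2 * (φ N + 1))
  classify with factor-out {2} (s≤s (s≤s z≤n)) N N≢0
  ... | _ , 0 , _ , 2∤0 = contradiction (2 ∣0) 2∤0
  ... | j , 1 , N≡2ʲ*1 , _ = contradiction (trans N≡2ʲ*1 (*-identityʳ (2 ^ j))) (not-power-of-2 j)
  ... | j , s@(suc (suc _)) , N≡2ʲs , 2∤s with prime-factor {s} (s≤s (s≤s z≤n))
  ...   | p , p-prime , p∣s = odd-prime-divisor p-prime 3≤p (subst (p ∣_) (sym N≡2ʲs) (∣n⇒∣m*n (2 ^ j) p∣s))
    where
    3≤p : 3 ≤ p
    3≤p = ≤∧≢⇒< (nonTrivial⇒n>1 p {{prime⇒nonTrivial p-prime}}) (λ 2≡p → 2∤s (subst (_∣ s) (sym 2≡p) p∣s))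

even-or-odd : ∀ m → (∃[ k ] m ≡ 2 * k) ⊎ (∃[ k ] m ≡ suc (k + k))
even-or-odd zero = inj₁ (0 , refl)
even-or-odd (suc m) with even-or-odd m
... | inj₁ (k , refl) = inj₂ (k , cong (λ j → suc (k + j)) (+-identityʳ k))
... | inj₂ (k , refl) = inj₁ (suc k , cong suc (trans (sym (+-suc k k)) (cong (λ j → k + suc j) (sym (+-identityʳ k)))))

module OddIndex {P n} (3≤P : 3 ≤ P) (1<n : 1 < n) (k : ℕ)
  (φ[uₙ]≡uₘ : φ (u P n) ≡ u P (suc (k + k))) where

  open LucasSequence P

  m : ℕ
  m = suc (k + k)

  φ[uₙ]≡X²+Y² : φ (u P n) ≡ u P (suc k) * u P (suc k) + u P k * u P k
  φ[uₙ]≡X²+Y² = trans φ[uₙ]≡uₘ (u-+ k k)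

  4∤φ[uₙ] : ¬ 4 ∣ φ (u P n)
  4∤φ[uₙ] = 4∤sum-of-coprime-squares (u-coprime-suc k) ∘ subst (4 ∣_) φ[uₙ]≡X²+Y²

  prime-factors≡1[4] : ∀ {q} → Prime q → 3 ≤ q → q ∣ φ (u P n) → 4 ∣ q ∸ 1
  prime-factors≡1[4] {q} q-prime 3≤q =
    prime∣sum-of-coprime-squares q-prime 3≤q (u-coprime-suc k) ∘ subst (q ∣_) φ[uₙ]≡X²+Y²

  uₙ≡uₘ+1⊎uₙ≡2[uₘ+1] : 3 ≤ u P m × (u P n ≡ u P m + 1 ⊎ u P n ≡ 2 * (u P m + 1))
  uₙ≡uₘ+1⊎uₙ≡2[uₘ+1] = subst (λ x → 3 ≤ x × (u P n ≡ x + 1 ⊎ u P n ≡ 2 * (x + 1))) φ[uₙ]≡uₘ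
    (Classification.classify (u-≥3 3≤P 1<n) 4∤φ[uₙ] (u≢2 3≤P m ∘ trans (sym φ[uₙ]≡uₘ)) prime-factors≡1[4])

  impossible : ⊥
  impossible = Sum.[ u≢u+1 3≤P {m} n (≤-trans (s≤s z≤n) 3≤uₘ) , u≢2[u+1] 3≤P {m} n 3≤uₘ ]
                 (proj₂ uₙ≡uₘ+1⊎uₙ≡2[uₘ+1])
    where
    3≤uₘ : 3 ≤ u P m
    3≤uₘ = proj₁ uₙ≡uₘ+1⊎uₙ≡2[uₘ+1]

lemma12 : (P n m : ℕ) → 3 ≤ P → 1 < n → 1 ≤ m →
          φ (u P n) ≡ u P m → ∃ λ k → m ≡ 2 * k
lemma12 P n m 3≤P 1<n _ φ[uₙ]≡uₘ with even-or-odd m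
... | inj₁ m-even = m-even
... | inj₂ (k , refl) = ⊥-elim (OddIndex.impossible 3≤P 1<n k φ[uₙ]≡uₘ)
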